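{- Let $a \geq 2$ and $n \geq 1$ be integers, and define rational numbers $G_{m,a}$ ($m \in \mathbb{N}$) by $$\frac{a t}{e^{(a-1)t} + e^{(a-2)t} + \dots + e^{t} + 1} = \sum_{m=0}^{\infty} G_{m,a} \frac{t^m}{m!}$$ in $\mathbb{Q}[[t]]$. Then for every prime $p$ not dividing $a$, $\vartheta_p(G_{n,a}) \geq 0$.
   Context: $\vartheta_p$ denotes the $p$-adic valuation on $\mathbb{Q}$. -}

module Defs where

open import Data.Nat as ℕ using (ℕ; zero; suc; _∸_; _!)
open import Data.Nat.Properties using (_!≢0)
open import Data.Nat.Divisibility using (_∣_)
open import Data.Integer using (+_)
open import Data.Rational using (ℚ; _+_; _*_; _/_; 0ℚ)
open import Relation.Nullary using (¬_)
open import Relation.Binary.PropositionalEquality using (_≡_)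

-- Formal power series over ℚ, given by their (ordinary) coefficients:
-- a series f stands for  Σ_m f m · t^m.
PowerSeries : Set
PowerSeries = ℕ → ℚ

sumTo : ℕ → (ℕ → ℚ) → ℚ
sumTo zero    f = f zero
sumTo (suc n) f = sumTo n f + f (suc n)

sumBelow : ℕ → (ℕ → ℚ) → ℚ
sumBelow zero    f = 0ℚ
sumBelow (suc n) f = sumBelow n f + f n

_⋆_ : PowerSeries → PowerSeries → PowerSeries
(f ⋆ g) m = sumTo m (λ k → f k * g (m ∸ k))

expSeries : ℕ → PowerSeries
expSeries j m = (+ (j ℕ.^ m) / (m !)) {{m !≢0}}

denomSeries : ℕ → PowerSeries
denomSeries a m = sumBelow a (λ j → expSeries j m)

numerSeries : ℕ → PowerSeries
numerSeries a 1 = + a / 1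
numerSeries a _ = 0ℚ

egf : (ℕ → ℚ) → PowerSeries
egf G m = G m * (+ 1 / (m !)) {{m !≢0}}

-- G satisfies  a t / (e^{(a-1)t} + ... + 1) = Σ G m t^m/m!  in ℚ[[t]],
-- i.e. (since the denominator has invertible constant term a)
-- a t = (e^{(a-1)t} + ... + 1) · Σ G m t^m/m!
IsGSeq : ℕ → (ℕ → ℚ) → Set
IsGSeq a G = ∀ m → numerSeries a m ≡ (denomSeries a ⋆ egf G) m

-- ϑ_p(x) ≥ 0 : for x in lowest terms num/den (den > 0), ϑ_p(x) = ϑ_p(num) − ϑ_p(den)
-- with at most one of these nonzero; so ϑ_p(x) ≥ 0 iff p ∤ den (x = 0 has den = 1, ϑ_p = ∞).
valuationNonneg : ℕ → ℚ → Set
valuationNonneg p x = ¬ (p ∣ ℚ.denominatorℕ x)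

-- Multiplying the defining identity by m! gives, with S_k = Σ_{j<a} j^k and S_0 = a,
--   a · G_m = m! · [t^m](a t) − Σ_{k=1}^{m} (m! / (k! (m−k)!)) · S_k · G_{m−k},
-- whose right side involves only integers and earlier G's.  By strong induction every
-- G_m lies in ℤ[1/a]: some a^e · G_m is an integer.  The reduced denominator of G_m
-- then divides a^e, so a prime p ∤ a cannot divide it.
module Submission where

open import Defs
open import Data.Nat using (ℕ; _≥_)
open import Data.Nat.Divisibility using (_∣_)
open import Data.Nat.Primality using (Prime)
open import Data.Rational using (ℚ)
open import Relation.Nullary using (¬_)

open import Data.Nat as ℕ using (zero; suc; _∸_; _!; _^_)
import Data.Nat.Properties as ℕP
open import Data.Nat.Properties using (_!≢0)
open import Data.Nat.Divisibility using (divides; ∣-trans; ∣1⇒≡1)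
open import Data.Nat.Primality using (euclidsLemma; ¬prime[1])
open import Data.Nat.Coprimality as Coprimality using (coprime-divisor; recompute)
open import Data.Nat.Combinatorics using (k![n∸k]!∣n!)
open import Data.Nat.Induction using (<-rec)
open import Data.Integer as ℤ using (ℤ; +_)
import Data.Integer.Properties as ℤP
open import Data.Rational as ℚ using (_+_; _*_; _/_; -_; 1ℚ; fromℚᵘ; toℚᵘ)
open import Data.Rational.Properties
open import Data.Rational.Unnormalised as ℚᵘ using (mkℚᵘ; *≡*)
import Data.Rational.Unnormalised.Properties as ℚᵘP
open import Data.Rational.Solver using (module +-*-Solver)
open import Data.Product using (∃-syntax; _,_)
open import Data.Sum using (inj₁; inj₂)
open import Relation.Binary.PropositionalEquality
open ≡-Reasoning
open +-*-Solver

fromℚᵘ-homo-+ : ∀ u v → fromℚᵘ (u ℚᵘ.+ v) ≡ fromℚᵘ u + fromℚᵘ v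
fromℚᵘ-homo-+ u v = toℚᵘ-injective (ℚᵘP.≃-trans (toℚᵘ-fromℚᵘ (u ℚᵘ.+ v))
  (ℚᵘP.≃-sym (ℚᵘP.≃-trans (toℚᵘ-homo-+ (fromℚᵘ u) (fromℚᵘ v))
    (ℚᵘP.+-cong (toℚᵘ-fromℚᵘ u) (toℚᵘ-fromℚᵘ v)))))

fromℚᵘ-homo-* : ∀ u v → fromℚᵘ (u ℚᵘ.* v) ≡ fromℚᵘ u * fromℚᵘ v
fromℚᵘ-homo-* u v = toℚᵘ-injective (ℚᵘP.≃-trans (toℚᵘ-fromℚᵘ (u ℚᵘ.* v))
  (ℚᵘP.≃-sym (ℚᵘP.≃-trans (toℚᵘ-homo-* (fromℚᵘ u) (fromℚᵘ v))
    (ℚᵘP.*-cong (toℚᵘ-fromℚᵘ u) (toℚᵘ-fromℚᵘ v)))))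

fromℚᵘ-homo‿- : ∀ u → fromℚᵘ (ℚᵘ.- u) ≡ - fromℚᵘ u
fromℚᵘ-homo‿- u = toℚᵘ-injective (ℚᵘP.≃-trans (toℚᵘ-fromℚᵘ (ℚᵘ.- u))
  (ℚᵘP.≃-sym (ℚᵘP.≃-trans (toℚᵘ-homo‿- (fromℚᵘ u)) (ℚᵘP.-‿cong (toℚᵘ-fromℚᵘ u)))))

fromℤ : ℤ → ℚ
fromℤ z = z / 1

fromℕ : ℕ → ℚ
fromℕ n = fromℤ (+ n)

fromℤ-homo-+ : ∀ x y → fromℤ (x ℤ.+ y) ≡ fromℤ x + fromℤ y
fromℤ-homo-+ x y = begin
  fromℤ (x ℤ.+ y)                  ≡⟨ cong fromℤ (cong₂ ℤ._+_ (ℤP.*-identityʳ x) (ℤP.*-identityʳ y)) ⟨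
  fromℚᵘ (mkℚᵘ x 0 ℚᵘ.+ mkℚᵘ y 0)  ≡⟨ fromℚᵘ-homo-+ (mkℚᵘ x 0) (mkℚᵘ y 0) ⟩
  fromℤ x + fromℤ y                ∎

fromℤ-homo-* : ∀ x y → fromℤ (x ℤ.* y) ≡ fromℤ x * fromℤ y
fromℤ-homo-* x y = fromℚᵘ-homo-* (mkℚᵘ x 0) (mkℚᵘ y 0)

fromℤ-homo‿- : ∀ x → fromℤ (ℤ.- x) ≡ - fromℤ x
fromℤ-homo‿- x = fromℚᵘ-homo‿- (mkℚᵘ x 0)

fromℕ-homo-+ : ∀ m n → fromℕ (m ℕ.+ n) ≡ fromℕ m + fromℕ n
fromℕ-homo-+ m n = trans (cong fromℤ (ℤP.pos-+ m n)) (fromℤ-homo-+ (+ m) (+ n))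

fromℕ-homo-* : ∀ m n → fromℕ (m ℕ.* n) ≡ fromℕ m * fromℕ n
fromℕ-homo-* m n = trans (cong fromℤ (ℤP.pos-* m n)) (fromℤ-homo-* (+ m) (+ n))

n/d≡n*1/d : ∀ n d .{{_ : ℕ.NonZero d}} → + n / d ≡ fromℕ n * (+ 1 / d)
n/d≡n*1/d n (suc d) = trans
  (fromℚᵘ-cong {mkℚᵘ (+ n) d} {mkℚᵘ (+ n) 0 ℚᵘ.* mkℚᵘ (+ 1) d}
    (*≡* (cong₂ ℤ._*_ (sym (ℤP.*-identityʳ (+ n))) (cong (λ k → + suc k) (ℕP.+-identityʳ d)))))
  (fromℚᵘ-homo-* (mkℚᵘ (+ n) 0) (mkℚᵘ (+ 1) d))

d*1/d≡1 : ∀ d .{{_ : ℕ.NonZero d}} → fromℕ d * (+ 1 / d) ≡ 1ℚ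
d*1/d≡1 (suc d) = trans (sym (n/d≡n*1/d (suc d) (suc d)))
  (fromℚᵘ-cong {mkℚᵘ (+ suc d) d} {mkℚᵘ (+ 1) 0} (*≡* (ℤP.*-comm (+ suc d) (+ 1))))

record _∈ℤ[1/_] (q : ℚ) (a : ℕ) : Set where
  constructor clearedBy
  field
    exponent : ℕ
    integer  : ℤ
    cleared  : q * fromℕ (a ^ exponent) ≡ fromℤ integer

module _ {a : ℕ} where

  fromℕ-a^-+ : ∀ e f → fromℕ (a ^ (e ℕ.+ f)) ≡ fromℕ (a ^ e) * fromℕ (a ^ f)
  fromℕ-a^-+ e f = trans (cong fromℕ (ℕP.^-distribˡ-+-* a e f)) (fromℕ-homo-* (a ^ e) (a ^ f))

  fromℤ∈ℤ[1/] : ∀ z → fromℤ z ∈ℤ[1/ a ]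
  fromℤ∈ℤ[1/] z = clearedBy 0 z (*-identityʳ (fromℤ z))

  +-∈ℤ[1/] : ∀ {q r} → q ∈ℤ[1/ a ] → r ∈ℤ[1/ a ] → (q + r) ∈ℤ[1/ a ]
  +-∈ℤ[1/] {q} {r} (clearedBy e x qAᵉ≡x) (clearedBy f y rAᶠ≡y) =
    clearedBy (e ℕ.+ f) (x ℤ.* + (a ^ f) ℤ.+ y ℤ.* + (a ^ e)) (begin
    (q + r) * fromℕ (a ^ (e ℕ.+ f))
      ≡⟨ cong ((q + r) *_) (fromℕ-a^-+ e f) ⟩
    (q + r) * (Aᵉ * Aᶠ)
      ≡⟨ solve 4 (λ q r x y → (q :+ r) :* (x :* y) := (q :* x) :* y :+ (r :* y) :* x) refl q r Aᵉ Aᶠ ⟩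
    (q * Aᵉ) * Aᶠ + (r * Aᶠ) * Aᵉ
      ≡⟨ cong₂ (λ u v → u * Aᶠ + v * Aᵉ) qAᵉ≡x rAᶠ≡y ⟩
    fromℤ x * Aᶠ + fromℤ y * Aᵉ
      ≡⟨ cong₂ _+_ (fromℤ-homo-* x (+ (a ^ f))) (fromℤ-homo-* y (+ (a ^ e))) ⟨
    fromℤ (x ℤ.* + (a ^ f)) + fromℤ (y ℤ.* + (a ^ e))
      ≡⟨ fromℤ-homo-+ (x ℤ.* + (a ^ f)) (y ℤ.* + (a ^ e)) ⟨
    fromℤ (x ℤ.* + (a ^ f) ℤ.+ y ℤ.* + (a ^ e)) ∎)
    where Aᵉ = fromℕ (a ^ e); Aᶠ = fromℕ (a ^ f)

  *-∈ℤ[1/] : ∀ {q r} → q ∈ℤ[1/ a ] → r ∈ℤ[1/ a ] → (q * r) ∈ℤ[1/ a ]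
  *-∈ℤ[1/] {q} {r} (clearedBy e x qAᵉ≡x) (clearedBy f y rAᶠ≡y) = clearedBy (e ℕ.+ f) (x ℤ.* y) (begin
    (q * r) * fromℕ (a ^ (e ℕ.+ f))
      ≡⟨ cong ((q * r) *_) (fromℕ-a^-+ e f) ⟩
    (q * r) * (Aᵉ * Aᶠ)
      ≡⟨ solve 4 (λ q r x y → (q :* r) :* (x :* y) := (q :* x) :* (r :* y)) refl q r Aᵉ Aᶠ ⟩
    (q * Aᵉ) * (r * Aᶠ)
      ≡⟨ cong₂ _*_ qAᵉ≡x rAᶠ≡y ⟩
    fromℤ x * fromℤ y
      ≡⟨ fromℤ-homo-* x y ⟨
    fromℤ (x ℤ.* y) ∎)
    where Aᵉ = fromℕ (a ^ e); Aᶠ = fromℕ (a ^ f)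

  neg-∈ℤ[1/] : ∀ {q} → q ∈ℤ[1/ a ] → (- q) ∈ℤ[1/ a ]
  neg-∈ℤ[1/] {q} (clearedBy e x qAᵉ≡x) = clearedBy e (ℤ.- x) (begin
    - q * fromℕ (a ^ e)                      ≡⟨ neg-distribˡ-* q (fromℕ (a ^ e)) ⟨
    - (q * fromℕ (a ^ e))                    ≡⟨ cong -_ qAᵉ≡x ⟩
    - fromℤ x                                ≡⟨ fromℤ-homo‿- x ⟨
    fromℤ (ℤ.- x)                            ∎)

  sumBelow-∈ℤ[1/] : ∀ n f → (∀ i → i ℕ.< n → f i ∈ℤ[1/ a ]) → sumBelow n f ∈ℤ[1/ a ]
  sumBelow-∈ℤ[1/] zero    f f∈ = fromℤ∈ℤ[1/] (+ 0)
  sumBelow-∈ℤ[1/] (suc n) f f∈ =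
    +-∈ℤ[1/] (sumBelow-∈ℤ[1/] n f (λ i i<n → f∈ i (ℕP.m<n⇒m<1+n i<n))) (f∈ n ℕP.≤-refl)

  a*q∈ℤ[1/]⇒q∈ℤ[1/] : ∀ {q} → (fromℕ a * q) ∈ℤ[1/ a ] → q ∈ℤ[1/ a ]
  a*q∈ℤ[1/]⇒q∈ℤ[1/] {q} (clearedBy e x aqAᵉ≡x) = clearedBy (suc e) x (begin
    q * fromℕ (a ^ suc e)
      ≡⟨ cong (q *_) (fromℕ-homo-* a (a ^ e)) ⟩
    q * (fromℕ a * fromℕ (a ^ e))
      ≡⟨ solve 3 (λ q x y → q :* (x :* y) := (x :* q) :* y) refl q (fromℕ a) (fromℕ (a ^ e)) ⟩
    (fromℕ a * q) * fromℕ (a ^ e)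
      ≡⟨ aqAᵉ≡x ⟩
    fromℤ x ∎)

denominator∣ : ∀ q n z → q * fromℕ n ≡ fromℤ z → ℚ.denominatorℕ q ∣ n
denominator∣ q@(ℚ.mkℚ num d-1 num⊥d) n z qn≡z =
  coprime-divisor (Coprimality.sym (recompute num⊥d)) (divides ℤ.∣ z ∣ (begin
    ℤ.∣ num ∣ ℕ.* n                  ≡⟨ ℤP.abs-* num (+ n) ⟨
    ℤ.∣ num ℤ.* + n ∣                ≡⟨ cong ℤ.∣_∣ (ℤP.*-identityʳ (num ℤ.* + n)) ⟨
    ℤ.∣ num ℤ.* + n ℤ.* + 1 ∣        ≡⟨ cong ℤ.∣_∣ cross-multiplied ⟩
    ℤ.∣ z ℤ.* + (suc d-1 ℕ.* 1) ∣    ≡⟨ ℤP.abs-* z (+ (suc d-1 ℕ.* 1)) ⟩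
    ℤ.∣ z ∣ ℕ.* (suc d-1 ℕ.* 1)      ≡⟨ cong (ℤ.∣ z ∣ ℕ.*_) (ℕP.*-identityʳ (suc d-1)) ⟩
    ℤ.∣ z ∣ ℕ.* suc d-1              ∎))
  where
  unnormalised : mkℚᵘ num d-1 ℚᵘ.* mkℚᵘ (+ n) 0 ℚᵘ.≃ mkℚᵘ z 0
  unnormalised = ℚᵘP.≃-trans (ℚᵘP.*-congˡ {mkℚᵘ num d-1} (ℚᵘP.≃-sym (toℚᵘ-fromℚᵘ (mkℚᵘ (+ n) 0))))
    (ℚᵘP.≃-trans (ℚᵘP.≃-sym (toℚᵘ-homo-* q (fromℕ n)))
    (ℚᵘP.≃-trans (toℚᵘ-cong qn≡z) (toℚᵘ-fromℚᵘ (mkℚᵘ z 0))))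
  cross-multiplied : num ℤ.* + n ℤ.* + 1 ≡ z ℤ.* + (suc d-1 ℕ.* 1)
  cross-multiplied with unnormalised
  ... | *≡* eq = eq

prime∤⇒∤^ : ∀ {p a} → Prime p → ¬ (p ∣ a) → ∀ e → ¬ (p ∣ a ^ e)
prime∤⇒∤^ p-prime p∤a zero    p∣1 = ¬prime[1] (subst Prime (∣1⇒≡1 p∣1) p-prime)
prime∤⇒∤^ {a = a} p-prime p∤a (suc e) p∣a^1+e with euclidsLemma a (a ^ e) p-prime p∣a^1+e
... | inj₁ p∣a   = p∤a p∣a
... | inj₂ p∣a^e = prime∤⇒∤^ p-prime p∤a e p∣a^e

∈ℤ[1/]⇒prime∤denominator : ∀ {q a p} → q ∈ℤ[1/ a ] → Prime p → ¬ (p ∣ a) → ¬ (p ∣ ℚ.denominatorℕ q)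
∈ℤ[1/]⇒prime∤denominator {q} (clearedBy e z qAᵉ≡z) p-prime p∤a p∣den =
  prime∤⇒∤^ p-prime p∤a e (∣-trans p∣den (denominator∣ q _ z qAᵉ≡z))

sumBelow-cong : ∀ n {f g : ℕ → ℚ} → (∀ i → f i ≡ g i) → sumBelow n f ≡ sumBelow n g
sumBelow-cong zero    f≗g = refl
sumBelow-cong (suc n) f≗g = cong₂ _+_ (sumBelow-cong n f≗g) (f≗g n)

sumBelow-*ʳ : ∀ n (f : ℕ → ℚ) c → sumBelow n f * c ≡ sumBelow n (λ i → f i * c)
sumBelow-*ʳ zero    f c = *-zeroˡ c
sumBelow-*ʳ (suc n) f c = trans (*-distribʳ-+ c (sumBelow n f) (f n)) (cong (_+ f n * c) (sumBelow-*ʳ n f c))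

sumBelow-*ˡ : ∀ n (f : ℕ → ℚ) c → c * sumBelow n f ≡ sumBelow n (λ i → c * f i)
sumBelow-*ˡ n f c = trans (*-comm c _) (trans (sumBelow-*ʳ n f c) (sumBelow-cong n (λ i → *-comm (f i) c)))

sumBelow-1 : ∀ n → sumBelow n (λ _ → 1ℚ) ≡ fromℕ n
sumBelow-1 zero    = refl
sumBelow-1 (suc n) = begin
  sumBelow n (λ _ → 1ℚ) + 1ℚ   ≡⟨ cong (_+ 1ℚ) (sumBelow-1 n) ⟩
  fromℕ n + fromℕ 1           ≡⟨ fromℕ-homo-+ n 1 ⟨
  fromℕ (n ℕ.+ 1)             ≡⟨ cong fromℕ (ℕP.+-comm n 1) ⟩
  fromℕ (suc n)               ∎

sumTo≡head+sumBelow : ∀ m (f : ℕ → ℚ) → sumTo m f ≡ f 0 + sumBelow m (λ i → f (suc i))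
sumTo≡head+sumBelow zero    f = sym (+-identityʳ (f 0))
sumTo≡head+sumBelow (suc m) f = trans (cong (_+ f (suc m)) (sumTo≡head+sumBelow m f)) (+-assoc (f 0) _ _)

powerSum : ℕ → ℕ → ℚ
powerSum a k = sumBelow a (λ j → fromℕ (j ^ k))

powerSum-0 : ∀ a → powerSum a 0 ≡ fromℕ a
powerSum-0 = sumBelow-1

powerSum∈ℤ[1/] : ∀ {b} a k → powerSum a k ∈ℤ[1/ b ]
powerSum∈ℤ[1/] a k = sumBelow-∈ℤ[1/] a _ (λ j _ → fromℤ∈ℤ[1/] (+ (j ^ k)))

denomSeries≡powerSum/k! : ∀ a k → denomSeries a k ≡ powerSum a k * (+ 1 / k !) {{k !≢0}}
denomSeries≡powerSum/k! a k = trans (sumBelow-cong a (λ j → n/d≡n*1/d (j ^ k) (k !) {{k !≢0}}))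
  (sym (sumBelow-*ʳ a _ ((+ 1 / k !) {{k !≢0}})))

numerSeries∈ℤ[1/] : ∀ a m → numerSeries a m ∈ℤ[1/ a ]
numerSeries∈ℤ[1/] a zero          = fromℤ∈ℤ[1/] (+ 0)
numerSeries∈ℤ[1/] a (suc zero)    = fromℤ∈ℤ[1/] (+ a)
numerSeries∈ℤ[1/] a (suc (suc m)) = fromℤ∈ℤ[1/] (+ 0)

module _ (a : ℕ) (G : ℕ → ℚ) where

  m!*term : ℕ → ℕ → ℚ
  m!*term m k = fromℕ (m !) * (denomSeries a k * egf G (m ∸ k))

  m!*term₀≡a*G : ∀ m → m!*term m 0 ≡ fromℕ a * G m
  m!*term₀≡a*G m = begin
    m! * (denomSeries a 0 * (G m * 1/m!)) ≡⟨ cong (λ x → m! * (x * (G m * 1/m!))) (powerSum-0 a) ⟩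
    m! * (fromℕ a * (G m * 1/m!))         ≡⟨ solve 4 (λ x y z w → x :* (y :* (z :* w)) := y :* z :* (x :* w))
                                                    refl m! (fromℕ a) (G m) 1/m! ⟩
    fromℕ a * G m * (m! * 1/m!)           ≡⟨ cong (fromℕ a * G m *_) (d*1/d≡1 (m !) {{m !≢0}}) ⟩
    fromℕ a * G m * 1ℚ                    ≡⟨ *-identityʳ _ ⟩
    fromℕ a * G m                         ∎
    where m! = fromℕ (m !); 1/m! = (+ 1 / m !) {{m !≢0}}

  m!*term≡binomial*powerSum*G : ∀ {m k} → k ℕ.≤ m → ∃[ C ] m!*term m k ≡ fromℕ C * powerSum a k * G (m ∸ k)
  m!*term≡binomial*powerSum*G {m} {k} k≤m with k![n∸k]!∣n! k≤m
  ... | divides C m!≡C*k!*l! = C , (begin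
    fromℕ (m !) * (denomSeries a k * (G l * 1/l!))
      ≡⟨ cong₂ (λ x y → x * (y * (G l * 1/l!))) m!≡ (denomSeries≡powerSum/k! a k) ⟩
    fromℕ C * (k! * l!) * (S * 1/k! * (G l * 1/l!))
      ≡⟨ solve 7 (λ c kf lf s x y g → c :* (kf :* lf) :* (s :* x :* (g :* y)) := c :* s :* g :* (kf :* x) :* (lf :* y))
           refl (fromℕ C) k! l! S 1/k! 1/l! (G l) ⟩
    fromℕ C * S * G l * (k! * 1/k!) * (l! * 1/l!)
      ≡⟨ cong₂ (λ x y → fromℕ C * S * G l * x * y) (d*1/d≡1 (k !) {{k !≢0}}) (d*1/d≡1 (l !) {{l !≢0}}) ⟩
    fromℕ C * S * G l * 1ℚ * 1ℚ
      ≡⟨ trans (*-identityʳ _) (*-identityʳ _) ⟩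
    fromℕ C * S * G l ∎)
    where
    l = m ∸ k
    S = powerSum a k
    k! = fromℕ (k !); l! = fromℕ (l !)
    1/k! = (+ 1 / k !) {{k !≢0}}; 1/l! = (+ 1 / l !) {{l !≢0}}
    m!≡ : fromℕ (m !) ≡ fromℕ C * (k! * l!)
    m!≡ = trans (cong fromℕ m!≡C*k!*l!)
      (trans (fromℕ-homo-* C _) (cong (fromℕ C *_) (fromℕ-homo-* (k !) (l !))))

  m!*term∈ℤ[1/] : ∀ {m k} → k ℕ.≤ m → G (m ∸ k) ∈ℤ[1/ a ] → m!*term m k ∈ℤ[1/ a ]
  m!*term∈ℤ[1/] {m} {k} k≤m G∈ =
    let C , eq = m!*term≡binomial*powerSum*G k≤m
    in subst (_∈ℤ[1/ a ]) (sym eq) (*-∈ℤ[1/] (*-∈ℤ[1/] (fromℤ∈ℤ[1/] (+ C)) (powerSum∈ℤ[1/] a k)) G∈)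

  module _ (isG : IsGSeq a G) where

    a*G-recurrence : ∀ m →
      fromℕ a * G m ≡ fromℕ (m !) * numerSeries a m + - sumBelow m (λ i → m!*term m (suc i))
    a*G-recurrence m = begin
      fromℕ a * G m
        ≡⟨ m!*term₀≡a*G m ⟨
      m! * f 0
        ≡⟨ solve 2 (λ x y → x := x :+ y :+ (:- y)) refl (m! * f 0) (m! * tail) ⟩
      m! * f 0 + m! * tail + - (m! * tail)
        ≡⟨ cong (_+ - (m! * tail)) (*-distribˡ-+ m! (f 0) tail) ⟨
      m! * (f 0 + tail) + - (m! * tail)
        ≡⟨ cong₂ (λ x y → m! * x + - y) (sym (trans (isG m) (sumTo≡head+sumBelow m f))) (sumBelow-*ˡ m _ m!) ⟩
      m! * numerSeries a m + - sumBelow m (λ i → m! * f (suc i)) ∎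
      where
      m! = fromℕ (m !)
      f : ℕ → ℚ
      f k = denomSeries a k * egf G (m ∸ k)
      tail = sumBelow m (λ i → f (suc i))

    G∈ℤ[1/] : ∀ m → G m ∈ℤ[1/ a ]
    G∈ℤ[1/] = <-rec (λ m → G m ∈ℤ[1/ a ]) λ m earlier∈ →
      a*q∈ℤ[1/]⇒q∈ℤ[1/] (subst (_∈ℤ[1/ a ]) (sym (a*G-recurrence m))
        (+-∈ℤ[1/] (*-∈ℤ[1/] (fromℤ∈ℤ[1/] (+ (m !))) (numerSeries∈ℤ[1/] a m))
          (neg-∈ℤ[1/] (sumBelow-∈ℤ[1/] m (λ i → m!*term m (suc i))
            λ i i<m → m!*term∈ℤ[1/] i<m (earlier∈ (ℕP.∸-monoʳ-< ℕ.z<s i<m))))))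

corollary3 : (a n : ℕ) → a ≥ 2 → n ≥ 1 → (G : ℕ → ℚ) → IsGSeq a G →
    (p : ℕ) → Prime p → ¬ (p ∣ a) → valuationNonneg p (G n)
corollary3 a n _ _ G isG p p-prime p∤a = ∈ℤ[1/]⇒prime∤denominator (G∈ℤ[1/] a G isG n) p-prime p∤a
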